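{- Let $n\geq 3$ and let $x=x_1\cdots x_{n-1}$ be a permutation of $[n-1]$. (1) If $x$ is a primitive G-word, then $w=(n,\ n-2,\ x_2,x_3,\dots,x_{n-2},\ n-1)$ is a primitive G-word. (2) If $x$ is a primitive R-word, then $w=(n,\ x_{n-2},x_{n-3},\dots,x_2,\ n-2,\ n-1)$ is a primitive R-word. (Here commas denote concatenation, and the block $x_2,\dots,x_{n-2}$ is empty when $n=3$.)
   Context: For a finite set $P$ of positive integers with $|P|=n$, a permutation $w$ of $P$ is written as a word $w=w_1w_2\cdots w_n$ with $\{w_1,\dots,w_n\}=P$. The reversal of $w$ is $w^*=w_nw_{n-1}\cdots w_1$. A subword of $w$ is a contiguous word $w[i,j]=w_iw_{i+1}\cdots w_j$ with $1\le i\le j\le n$; it is proper if $w[i,j]\neq w$. Let $|P|=n\geq 2$. A permutation $w$ of $P$ is a G-word if (G1) $w_1=\max(P)$ and $w_n=\max(P\setminus\{w_1\})$, and (G2) if $n\geq 4$ then $w_2>w_{n-1}$. It is an R-word if (R1) $w_1=\max(P)$ and $w_n=\max(P\setminus\{w_1\})$, and (R2) if $n\geq 4$ then $w_2<w_{n-1}$. A G-word (resp. R-word) $w$ is primitive if for every proper subword $x$ of $w$ of length at least $4$, neither $x$ nor $x^*$ is a G-word (resp. R-word). -}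

module Defs where

open import Data.Nat using (ℕ; _≤_; _<_; _∸_; suc)
open import Data.List using (List; []; _∷_; _++_; [_]; length; reverse; take; drop; map; upTo)
open import Data.List.Membership.Propositional using (_∈_)
open import Data.List.Relation.Unary.All using (All)
open import Data.List.Relation.Unary.Unique.Propositional using (Unique)
open import Data.Product using (Σ; ∃; _×_; _,_)
open import Relation.Binary.PropositionalEquality using (_≡_; _≢_)
open import Relation.Nullary using (¬_)

-- A word w is a permutation of the finite set P of positive integers
-- consisting of its letters: letters are distinct and positive.
IsPermWord : List ℕ → Set
IsPermWord w = Unique w × All (1 ≤_) w

-- Shared conditions (G1)/(R1): w = a · mid · b with |w| ≥ 2,
-- a = max(P), b = max(P \ {a}).
record Ends (w : List ℕ) : Set where
  constructor ends
  field
    first : ℕ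
    middle : List ℕ
    lastL : ℕ
    shape : w ≡ first ∷ (middle ++ [ lastL ])
    firstMax : ∀ y → y ∈ w → y ≤ first
    lastNe : lastL ≢ first
    lastMax : ∀ y → y ∈ w → y ≢ first → y ≤ lastL

-- G-word: (G1) and (G2): if |w| ≥ 4 (i.e. middle = c · m · d) then w₂ > w_{n-1}.
IsGWord : List ℕ → Set
IsGWord w = IsPermWord w × Σ (Ends w) λ e →
  ∀ c m d → Ends.middle e ≡ c ∷ (m ++ [ d ]) → d < c

-- R-word: (R1) and (R2): if |w| ≥ 4 then w₂ < w_{n-1}.
IsRWord : List ℕ → Set
IsRWord w = IsPermWord w × Σ (Ends w) λ e →
  ∀ c m d → Ends.middle e ≡ c ∷ (m ++ [ d ]) → c < d

ProperSubword : List ℕ → List ℕ → Set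
ProperSubword x w = (∃ λ u → ∃ λ v → w ≡ u ++ (x ++ v)) × x ≢ w

PrimitiveG : List ℕ → Set
PrimitiveG w = IsGWord w ×
  (∀ x → ProperSubword x w → 4 ≤ length x → ¬ IsGWord x × ¬ IsGWord (reverse x))

PrimitiveR : List ℕ → Set
PrimitiveR w = IsRWord w ×
  (∀ x → ProperSubword x w → 4 ≤ length x → ¬ IsRWord x × ¬ IsRWord (reverse x))

range1 : ℕ → List ℕ
range1 k = map suc (upTo k)

-- for x = x₁⋯x_{n-1}: the block x₂,…,x_{n-2}
innerBlock : ℕ → List ℕ → List ℕ
innerBlock n x = take (n ∸ 3) (drop 1 x)

wordG : ℕ → List ℕ → List ℕ
wordG n x = n ∷ (n ∸ 2) ∷ (innerBlock n x ++ [ n ∸ 1 ])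

wordR : ℕ → List ℕ → List ℕ
wordR n x = n ∷ (reverse (innerBlock n x) ++ ((n ∸ 2) ∷ (n ∸ 1) ∷ []))

-- Write x = f M l: then f = n-1 and l = n-2 are the two largest letters and M lies below l.
-- The new words are n (l M) f and n (l M)* f, framed by the new maximum n and by f, with l at
-- the inner end where it makes (G2), resp. (R2), hold. Primitivity is invariant under reversal,
-- which turns the second word into f (l M) n, so it suffices to treat a (l M) b with l < a, b for
-- an arbitrary asymmetric comparison. A subword of length at least 4 then either ends (or, read
-- backwards, starts) below the interior letter l; or is l M b, whose reverse would impose the
-- reversed inner condition on M; or becomes (the reverse of) a proper subword of x once its
-- first letter is replaced by f or l, which keeps G- and R-words G- and R-words.
module Submission where

open import Defs
open import Data.Nat using (ℕ; suc; _≤_; _<_; _>_; _∸_; _+_; z≤n; s≤s)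
open import Data.Nat.Properties
  using ( ≤-refl; ≤-trans; ≤-antisym; ≤-pred; <-trans; <-irrefl; <-asym; <⇒≤; <⇒≢; <⇒≱; ≤∧≢⇒<
        ; +-comm; n≤1+n; 1+n≢n; suc-injective)
open import Data.List
  using (List; []; _∷_; _++_; _∷ʳ_; [_]; length; reverse; take; upTo; initLast; _∷ʳ′_)
open import Data.List.Properties
  using ( ∷-injective; ∷-injectiveˡ; ∷-injectiveʳ; ∷ʳ-injective; ∷ʳ-injectiveˡ
        ; ++-assoc; ++-identityʳ; ++-identityʳ-unique; ++-conicalʳ
        ; length-++; length-++-≤ˡ; length-++-≤ʳ; length-map; length-upTo; length-reverse
        ; reverse-++; reverse-involutive; reverse-injective; unfold-reverse)
open import Data.List.Membership.Propositional using (_∈_; _∉_)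
open import Data.List.Membership.Propositional.Properties
  using (∈-++⁺ˡ; ∈-++⁺ʳ; ∈-map⁺; ∈-map⁻; ∈-upTo⁺; ∈-upTo⁻)
open import Data.List.Relation.Unary.Any using (here; there)
import Data.List.Relation.Unary.Any.Properties as Any
open import Data.List.Relation.Unary.All as All using (All; []; _∷_)
open import Data.List.Relation.Unary.All.Properties using (++⁻ˡ; ++⁻ʳ; ∷ʳ⁺; ∷ʳ⁻)
open import Data.List.Relation.Unary.AllPairs using ([]; _∷_)
open import Data.List.Relation.Unary.Unique.Propositional using (Unique)
import Data.List.Relation.Unary.Unique.Propositional.Properties as Unique
open import Data.List.Relation.Binary.Permutation.Propositional using (_↭_; ↭-sym; ↭⇒↭ₛ)
open import Data.List.Relation.Binary.Permutation.Propositional.Properties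
  using (All-resp-↭; ∈-resp-↭; ↭-length; ↭-reverse)
open import Data.List.Relation.Binary.Permutation.Setoid.Properties using (Unique-resp-↭)
open import Data.Product using (Σ; ∃; _×_; _,_; proj₁; proj₂)
open import Data.Sum using (_⊎_; inj₁; inj₂)
open import Data.Empty using (⊥-elim)
open import Function using (flip; _∘_; case_of_)
open import Relation.Binary.Definitions using (Asymmetric)
open import Relation.Binary.PropositionalEquality
  using (_≡_; _≢_; refl; sym; trans; cong; cong₂; subst; setoid; ≢-sym; module ≡-Reasoning)
open import Relation.Nullary using (¬_)

split-∷≡++ : ∀ {A : Set} {x : A} {xs} ys {zs} → x ∷ xs ≡ ys ++ zs →
  (ys ≡ [] × zs ≡ x ∷ xs) ⊎ ∃ λ ys′ → ys ≡ x ∷ ys′ × xs ≡ ys′ ++ zs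
split-∷≡++ []       eq = inj₁ (refl , sym eq)
split-∷≡++ (y ∷ ys) eq with refl , xs≡ ← ∷-injective eq = inj₂ (ys , refl , xs≡)

take-length-++ : ∀ {A : Set} (xs ys : List A) → take (length xs) (xs ++ ys) ≡ xs
take-length-++ []       ys = refl
take-length-++ (x ∷ xs) ys = cong (x ∷_) (take-length-++ xs ys)

length-∷ʳ : ∀ {A : Set} (xs : List A) x → length (xs ∷ʳ x) ≡ suc (length xs)
length-∷ʳ xs x = trans (length-++ xs) (+-comm (length xs) 1)

reverse-∷-∷ʳ : ∀ {A : Set} (a : A) m b → reverse (a ∷ m ∷ʳ b) ≡ b ∷ reverse m ∷ʳ a
reverse-∷-∷ʳ a m b = trans (reverse-++ (a ∷ m) [ b ]) (cong (b ∷_) (unfold-reverse a m))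

All-reverse : ∀ {P : ℕ → Set} {xs} → All P xs → All P (reverse xs)
All-reverse {xs = xs} = All-resp-↭ (↭-sym (↭-reverse xs))

Unique-reverse : ∀ {xs : List ℕ} → Unique xs → Unique (reverse xs)
Unique-reverse {xs} = Unique-resp-↭ (setoid ℕ) (↭⇒↭ₛ (↭-sym (↭-reverse xs)))

Unique[xs∷ʳx]⇒x∉xs : ∀ {xs : List ℕ} {x} → Unique (xs ∷ʳ x) → x ∉ xs
Unique[xs∷ʳx]⇒x∉xs {xs} {x} u x∈xs =
  Unique.Unique[x∷xs]⇒x∉xs (subst Unique (reverse-++ xs [ x ]) (Unique-reverse u)) (Any.reverse⁺ x∈xs)

Subword : List ℕ → List ℕ → Set
Subword z w = ∃ λ u → ∃ λ v → w ≡ u ++ (z ++ v)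

properSubword-reverse : ∀ {z w} → ProperSubword z w → ProperSubword (reverse z) (reverse w)
properSubword-reverse {z} ((u , v , refl) , z≢w) = (reverse v , reverse u , eq) , z≢w ∘ reverse-injective
  where
  eq : reverse (u ++ (z ++ v)) ≡ reverse v ++ (reverse z ++ reverse u)
  eq = begin
    reverse (u ++ (z ++ v))               ≡⟨ reverse-++ u (z ++ v) ⟩
    reverse (z ++ v) ++ reverse u         ≡⟨ cong (_++ reverse u) (reverse-++ z v) ⟩
    (reverse v ++ reverse z) ++ reverse u ≡⟨ ++-assoc (reverse v) (reverse z) (reverse u) ⟩
    reverse v ++ (reverse z ++ reverse u) ∎
    where open ≡-Reasoning

interior-properSubword : ∀ y u z v → ProperSubword z (y ∷ u ++ (z ++ v))
interior-properSubword y u z v = (y ∷ u , v , refl) , λ eq → <-irrefl (cong length eq) shorter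
  where
  shorter : length z < length (y ∷ u ++ (z ++ v))
  shorter = s≤s (≤-trans (length-++-≤ˡ z) (length-++-≤ʳ (z ++ v) {u}))

data ProperSubwordView (a : ℕ) (s : List ℕ) (b : ℕ) : List ℕ → Set where
  prefix : ∀ {p q} → s ≡ p ++ q → ProperSubwordView a s b (a ∷ p)
  suffix : ∀ {q p} → s ≡ q ++ p → ProperSubwordView a s b (p ∷ʳ b)
  inside : ∀ {z} → Subword z s → ProperSubwordView a s b z

module _ {a : ℕ} {s : List ℕ} {b : ℕ} where

  properSubwordView : ∀ z → ProperSubword z (a ∷ s ++ [ b ]) → ProperSubwordView a s b z
  properSubwordView z (([] , v , eq) , z≢w) with initLast v
  ... | [] = ⊥-elim (z≢w (sym (trans eq (++-identityʳ z))))
  ... | v′ ∷ʳ′ y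
    with split-∷≡++ z (∷ʳ-injectiveˡ (a ∷ s) (z ++ v′) (trans eq (sym (++-assoc z v′ [ y ]))))
  ...   | inj₁ (refl , _)        = inside ([] , s , refl)
  ...   | inj₂ (_ , refl , s≡)   = prefix s≡
  properSubwordView z ((_ ∷ u , v , eq) , _) with initLast v | initLast z
  ... | [] | [] = inside ([] , s , refl)
  ... | [] | z′ ∷ʳ′ y
    with s≡ , refl ← ∷ʳ-injective s (u ++ z′) (trans (∷-injectiveʳ eq)
                       (trans (cong (u ++_) (++-identityʳ (z′ ∷ʳ y))) (sym (++-assoc u z′ [ y ]))))
    = suffix s≡
  ... | v′ ∷ʳ′ y | _ = inside (u , v′ , ∷ʳ-injectiveˡ s _ s∷ʳb≡)
    where
    s∷ʳb≡ : s ∷ʳ b ≡ (u ++ (z ++ v′)) ∷ʳ y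
    s∷ʳb≡ = trans (∷-injectiveʳ eq)
      (sym (trans (++-assoc u (z ++ v′) [ y ]) (cong (u ++_) (++-assoc z v′ [ y ]))))

  prefix-properSubword : ∀ {p q} → s ≡ p ++ q → ProperSubword (a ∷ p) (a ∷ s ++ [ b ])
  prefix-properSubword {p} {q} refl = ([] , q ∷ʳ b , cong (a ∷_) (++-assoc p q [ b ])) , λ eq →
    case ++-identityʳ-unique p (trans (∷-injectiveʳ eq) (++-assoc p q [ b ])) of λ q∷ʳb≡[] →
    case ++-conicalʳ q [ b ] q∷ʳb≡[] of λ ()

  suffix-properSubword : ∀ {q p} → s ≡ q ++ p → ProperSubword (p ∷ʳ b) (a ∷ s ++ [ b ])
  suffix-properSubword {q} {p} refl =
    subst (ProperSubword (p ∷ʳ b)) (cong (a ∷_) eq) (interior-properSubword a q (p ∷ʳ b) [])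
    where
    eq : q ++ ((p ∷ʳ b) ++ []) ≡ (q ++ p) ∷ʳ b
    eq = trans (cong (q ++_) (++-identityʳ (p ∷ʳ b))) (sym (++-assoc q p [ b ]))

  inside-properSubword : ∀ {z} → Subword z s → ProperSubword z (a ∷ s ++ [ b ])
  inside-properSubword {z} (u , v , refl) =
    subst (ProperSubword z) (cong (a ∷_) eq) (interior-properSubword a u z (v ∷ʳ b))
    where
    eq : u ++ (z ++ (v ∷ʳ b)) ≡ (u ++ (z ++ v)) ∷ʳ b
    eq = sym (trans (++-assoc u (z ++ v) [ b ]) (cong (u ++_) (++-assoc z v [ b ])))

Inner : (ℕ → ℕ → Set) → List ℕ → Set
Inner _◁_ m = ∀ c m′ d → m ≡ c ∷ (m′ ++ [ d ]) → c ◁ d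

-- IsGWord = Word _>_, IsRWord = Word _<_ and PrimitiveG w = IsGWord w × Avoids IsGWord w
-- hold definitionally, and likewise for R.
Word : (ℕ → ℕ → Set) → List ℕ → Set
Word _◁_ w = IsPermWord w × Σ (Ends w) λ e → Inner _◁_ (Ends.middle e)

Excluded : (List ℕ → Set) → List ℕ → Set
Excluded W z = ¬ W z × ¬ W (reverse z)

Avoids : (List ℕ → Set) → List ℕ → Set
Avoids W w = ∀ z → ProperSubword z w → 4 ≤ length z → Excluded W z

avoids-reverse : ∀ {W w} → Avoids W w → Avoids W (reverse w)
avoids-reverse {W} {w} avoids z z⊏w′ |z|
  with ¬Wz′ , ¬Wz″ ← avoids (reverse z)
                       (subst (ProperSubword _) (reverse-involutive w) (properSubword-reverse z⊏w′))
                       (subst (4 ≤_) (sym (length-reverse z)) |z|)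
  = (λ Wz → ¬Wz″ (subst W (sym (reverse-involutive z)) Wz)) , ¬Wz′

record Framed (_◁_ : ℕ → ℕ → Set) (a : ℕ) (m : List ℕ) (b : ℕ) : Set where
  field
    last<head : b < a
    middle<last : All (_< b) m
    unique : Unique m
    positive : All (1 ≤_) (b ∷ m)
    inner : Inner _◁_ m

module _ {_◁_ : ℕ → ℕ → Set} where

  inner-reverse : ∀ {m} → Inner _◁_ m → Inner (flip _◁_) (reverse m)
  inner-reverse {m} inner c m′ d eq = inner d (reverse m′) c (begin
    m                            ≡⟨ reverse-involutive m ⟨
    reverse (reverse m)          ≡⟨ cong reverse eq ⟩
    reverse (c ∷ m′ ∷ʳ d)        ≡⟨ reverse-∷-∷ʳ c m′ d ⟩
    d ∷ reverse m′ ∷ʳ c          ∎)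
    where open ≡-Reasoning

  ¬inner-reverse : Asymmetric _◁_ → ∀ m → 2 ≤ length m → Inner _◁_ m → ¬ Inner _◁_ (reverse m)
  ¬inner-reverse asym (c ∷ m) |m| inner inner′ with initLast m
  ¬inner-reverse asym (c ∷ .[]) (s≤s ()) _ _ | []
  ... | m′ ∷ʳ′ d = asym (inner c m′ d refl) (inner′ d (reverse m′) c (reverse-∷-∷ʳ c m′ d))

  framed⇒word : ∀ {a m b} → Framed _◁_ a m b → Word _◁_ (a ∷ m ++ [ b ])
  framed⇒word {a} {m} {b} fr =
    (unique-word , positive-word) , ends a m b refl head-max (<⇒≢ last<head) last-max , inner
    where
    open Framed fr
    below-a : All (_< a) (m ∷ʳ b)
    below-a = ∷ʳ⁺ (All.map (λ y<b → <-trans y<b last<head) middle<last) last<head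
    unique-word : Unique (a ∷ m ∷ʳ b)
    unique-word = All.map (λ y<a a≡y → <⇒≢ y<a (sym a≡y)) below-a
                ∷ Unique.++⁺ unique ([] ∷ [])
                    λ { (y∈m , here refl) → <-irrefl refl (All.lookup middle<last y∈m) }
    positive-word : All (1 ≤_) (a ∷ m ∷ʳ b)
    positive-word = ≤-trans (s≤s z≤n) last<head ∷ ∷ʳ⁺ (All.tail positive) (All.head positive)
    head-max : ∀ y → y ∈ a ∷ m ∷ʳ b → y ≤ a
    head-max _ (here refl) = ≤-refl
    head-max _ (there y∈) = <⇒≤ (All.lookup below-a y∈)
    last-max : ∀ y → y ∈ a ∷ m ∷ʳ b → y ≢ a → y ≤ b
    last-max _ (here refl) y≢a = ⊥-elim (y≢a refl)
    last-max _ (there y∈) _ = All.lookup (∷ʳ⁺ (All.map <⇒≤ middle<last) ≤-refl) y∈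

  word⇒framed : ∀ {a m b} → Word _◁_ (a ∷ m ++ [ b ]) → Framed _◁_ a m b
  word⇒framed {a} {m} {b}
    ((a∉ ∷ unique′ , _ ∷ positive′) , ends _ middle _ shape firstMax lastNe lastMax , inner)
    with refl ← ∷-injectiveˡ shape
    with refl , refl ← ∷ʳ-injective m middle (∷-injectiveʳ shape) = record
    { last<head = ≤∧≢⇒< (firstMax b (there (∈-++⁺ʳ m (here refl)))) lastNe
    ; middle<last = All.tabulate λ y∈m →
        ≤∧≢⇒< (lastMax _ (there (∈-++⁺ˡ y∈m)) (≢-sym (All.lookup a∉ (∈-++⁺ˡ y∈m))))
              (λ { refl → Unique[xs∷ʳx]⇒x∉xs unique′ y∈m })
    ; unique = subst Unique (take-length-++ m [ b ]) (Unique.take⁺ (length m) unique′)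
    ; positive = proj₂ (∷ʳ⁻ positive′) ∷ proj₁ (∷ʳ⁻ positive′)
    ; inner = inner
    }

  ¬word-[_] : ∀ a → ¬ Word _◁_ [ a ]
  ¬word-[ a ] (_ , ends _ middle _ shape _ _ _ , _)
    with () ← ++-conicalʳ middle [ _ ] (sym (∷-injectiveʳ shape))

  ¬word-∷ : ∀ {a y r} → y ∈ r → a < y → ¬ Word _◁_ (a ∷ r)
  ¬word-∷ y∈r a<y (_ , ends _ _ _ shape firstMax _ _ , _) =
    <⇒≱ a<y (subst (_ ≤_) (sym (∷-injectiveˡ shape)) (firstMax _ (there y∈r)))

  ¬word-reverse-∷ʳ : ∀ {p y r} → y ∈ r → p < y → ¬ Word _◁_ (reverse (r ∷ʳ p))
  ¬word-reverse-∷ʳ {p} {r = r} y∈r p<y w =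
    ¬word-∷ (Any.reverse⁺ y∈r) p<y (subst (Word _◁_) (reverse-++ r [ p ]) w)

  word-∷-replace : ∀ {a a′ r} → All (_< a′) r → Word _◁_ (a ∷ r) → Word _◁_ (a′ ∷ r)
  word-∷-replace {a} {r = r} r<a′ w with initLast r
  ... | []     = ⊥-elim (¬word-[ a ] w)
  ... | m ∷ʳ′ b = framed⇒word record
    { last<head = proj₂ (∷ʳ⁻ r<a′)
    ; middle<last = middle<last
    ; unique = unique
    ; positive = positive
    ; inner = inner
    }
    where open Framed (word⇒framed w)

  framed-reverse : ∀ {a m b} → Framed _◁_ a m b → Framed (flip _◁_) a (reverse m) b
  framed-reverse fr = record
    { last<head = last<head
    ; middle<last = All-reverse middle<last
    ; unique = Unique-reverse unique
    ; positive = All.head positive ∷ All-reverse (All.tail positive)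
    ; inner = inner-reverse inner
    }
    where open Framed fr

  framed-extend : ∀ {f M l N} → Framed _◁_ f M l → f < N → Framed _>_ N (l ∷ M) f
  framed-extend {f} {M} {l} fr f<N = record
    { last<head = f<N
    ; middle<last = last<head ∷ All.map (λ y<l → <-trans y<l last<head) middle<last
    ; unique = All.map (λ y<l l≡y → <⇒≢ y<l (sym l≡y)) middle<last ∷ unique
    ; positive = ≤-trans (All.head positive) (<⇒≤ last<head) ∷ positive
    ; inner = inner-∷
    }
    where
    open Framed fr
    inner-∷ : Inner _>_ (l ∷ M)
    inner-∷ c m′ d eq with refl , refl ← ∷-injective eq = proj₂ (∷ʳ⁻ middle<last)

module _ {_◁_ : ℕ → ℕ → Set} (asym : Asymmetric _◁_) {f l : ℕ} {M : List ℕ}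
         (fr : Framed _◁_ f M l) (avoids : Avoids (Word _◁_) (f ∷ M ++ [ l ]))
         {a b : ℕ} (l<a : l < a) (l<b : l < b) where

  open Framed fr renaming (last<head to l<f; middle<last to M<l)

  private
    prefix<l : ∀ p {q} → M ≡ p ++ q → All (_< l) p
    prefix<l p M≡ = ++⁻ˡ p (subst (All (_< l)) M≡ M<l)

    suffix<l : ∀ q {p} → M ≡ q ++ p → All (_< l) p
    suffix<l q M≡ = ++⁻ʳ q (subst (All (_< l)) M≡ M<l)

    from-a : ∀ p {q} → M ≡ p ++ q → 4 ≤ length (a ∷ l ∷ p) → Excluded (Word _◁_) (a ∷ l ∷ p)
    from-a p M≡ |z| with initLast p
    from-a .[] _ (s≤s (s≤s ())) | []
    ... | p′ ∷ʳ′ y =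
        (λ w → <-asym y<l (All.head (Framed.middle<last (word⇒framed {m = l ∷ p′} {b = y} w))))
      , ¬word-reverse-∷ʳ {r = a ∷ l ∷ p′} (there (here refl)) y<l
      where
      y<l : y < l
      y<l = proj₂ (∷ʳ⁻ (prefix<l (p′ ∷ʳ y) M≡))

    from-l : ∀ p {q} → M ≡ p ++ q → 4 ≤ length (l ∷ p) → Excluded (Word _◁_) (l ∷ p)
    from-l p M≡ |z| with initLast p
    from-l .[] _ (s≤s ()) | []
    ... | p′ ∷ʳ′ y =
        (λ w → proj₁ (avoids (f ∷ p′ ∷ʳ y) (prefix-properSubword M≡) |z|)
                     (word-∷-replace (All.map (λ y<l → <-trans y<l l<f) p<l) w))
      , ¬word-reverse-∷ʳ {r = l ∷ p′} (here refl) (proj₂ (∷ʳ⁻ p<l))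
      where
      p<l : All (_< l) (p′ ∷ʳ y)
      p<l = prefix<l (p′ ∷ʳ y) M≡

    from-l-to-b : 4 ≤ length (l ∷ M ∷ʳ b) → Excluded (Word _◁_) (l ∷ M ∷ʳ b)
    from-l-to-b |z| =
        ¬word-∷ (∈-++⁺ʳ M (here refl)) l<b
      , λ w → ¬inner-reverse asym M |M| inner
                (Framed.inner (word⇒framed (subst (Word _◁_) (reverse-∷-∷ʳ l M b) w)))
      where
      |M| : 2 ≤ length M
      |M| = ≤-pred (≤-pred (subst (4 ≤_) (cong suc (length-∷ʳ M b)) |z|))

    to-b : ∀ {q} p → M ≡ q ++ p → 4 ≤ length (p ∷ʳ b) → Excluded (Word _◁_) (p ∷ʳ b)
    to-b [] _ (s≤s ())
    to-b {q} (y ∷ p) M≡ |z| =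
        ¬word-∷ (∈-++⁺ʳ p (here refl)) (<-trans (All.head p<l) l<b)
      , λ w → proj₂ (avoids ((y ∷ p) ∷ʳ l) (suffix-properSubword {q = q} M≡) |z|′)
                (subst (Word _◁_) (sym (reverse-++ (y ∷ p) [ l ]))
                  (word-∷-replace (All-reverse p<l)
                    (subst (Word _◁_) (reverse-++ (y ∷ p) [ b ]) w)))
      where
      p<l : All (_< l) (y ∷ p)
      p<l = suffix<l q M≡
      |z|′ : 4 ≤ length ((y ∷ p) ∷ʳ l)
      |z|′ = subst (4 ≤_) (trans (length-∷ʳ (y ∷ p) b) (sym (length-∷ʳ (y ∷ p) l))) |z|

  avoids-extend : Avoids (Word _◁_) (a ∷ (l ∷ M) ++ [ b ])
  avoids-extend z z⊏w |z| with properSubwordView {s = l ∷ M} z z⊏w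
  ... | prefix {p} l∷M≡ with split-∷≡++ p l∷M≡
  ...   | inj₂ (p′ , refl , M≡) = from-a p′ M≡ |z|
  avoids-extend _ _ (s≤s ()) | prefix _ | inj₁ (refl , _)
  avoids-extend z z⊏w |z| | suffix {q} l∷M≡ with split-∷≡++ q l∷M≡
  ...   | inj₁ (refl , refl) = from-l-to-b |z|
  ...   | inj₂ (_ , refl , M≡) = to-b _ M≡ |z|
  avoids-extend z z⊏w |z| | inside (u , v , l∷M≡) with split-∷≡++ u l∷M≡
  ...   | inj₂ (u′ , refl , M≡) = avoids z (inside-properSubword (u′ , v , M≡)) |z|
  ...   | inj₁ (refl , z++v≡) with split-∷≡++ z (sym z++v≡)
  ...     | inj₂ (p , refl , M≡) = from-l p M≡ |z|
  avoids-extend _ _ () | inside _ | inj₁ _ | inj₁ (refl , _)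

primitiveG-extend : ∀ {f M l N} → f < N →
  PrimitiveG (f ∷ M ++ [ l ]) → PrimitiveG (N ∷ (l ∷ M) ++ [ f ])
primitiveG-extend {f} {M} {l} f<N (isG , avoids) =
  framed⇒word (framed-extend fr f<N) , avoids-extend <-asym fr avoids (<-trans l<f f<N) l<f
  where
  fr : Framed _>_ f M l
  fr = word⇒framed isG
  l<f = Framed.last<head fr

primitiveR-extend : ∀ {f M l N} → f < N →
  PrimitiveR (f ∷ M ++ [ l ]) → PrimitiveR (N ∷ reverse (l ∷ M) ++ [ f ])
primitiveR-extend {f} {M} {l} {N} f<N (isR , avoids) =
    framed⇒word (framed-reverse (framed-extend fr f<N))
  , subst (Avoids IsRWord) (reverse-∷-∷ʳ f (l ∷ M) N)
      (avoids-reverse (avoids-extend <-asym fr avoids l<f (<-trans l<f f<N)))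
  where
  fr : Framed _<_ f M l
  fr = word⇒framed isR
  l<f = Framed.last<head fr

∈-range1⁻ : ∀ {y n} → y ∈ range1 n → y ≤ n
∈-range1⁻ y∈ with _ , j∈ , refl ← ∈-map⁻ suc y∈ = ∈-upTo⁻ j∈

∈-range1⁺ : ∀ {j n} → j < n → suc j ∈ range1 n
∈-range1⁺ j<n = ∈-map⁺ suc (∈-upTo⁺ j<n)

length-range1 : ∀ n → length (range1 n) ≡ n
length-range1 n = trans (length-map suc (upTo n)) (length-upTo n)

range1-ends : ∀ {k x} → x ↭ range1 (suc (suc k)) → Ends x →
  ∃ λ M → x ≡ suc (suc k) ∷ M ++ [ suc k ] × innerBlock (3 + k) x ≡ M
range1-ends {k} x↭ (ends first M last refl firstMax lastNe lastMax) =
    M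
  , cong₂ (λ a b → a ∷ M ∷ʳ b) first≡ last≡
  , subst (λ n → take n (M ∷ʳ last) ≡ M) |M| (take-length-++ M [ last ])
  where
  in-range : ∀ {y} → y ∈ first ∷ M ∷ʳ last → y ≤ suc (suc k)
  in-range y∈ = ∈-range1⁻ (∈-resp-↭ x↭ y∈)
  present : ∀ {j} → j < suc (suc k) → suc j ∈ first ∷ M ∷ʳ last
  present j< = ∈-resp-↭ (↭-sym x↭) (∈-range1⁺ j<)
  first≡ : first ≡ suc (suc k)
  first≡ = ≤-antisym (in-range (here refl)) (firstMax _ (present ≤-refl))
  last≡ : last ≡ suc k
  last≡ = ≤-antisym
    (≤-pred (≤∧≢⇒< (in-range (there (∈-++⁺ʳ M (here refl)))) λ eq → lastNe (trans eq (sym first≡))))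
    (lastMax _ (present (n≤1+n (suc k))) λ eq → 1+n≢n (sym (trans eq first≡)))
  |M| : length M ≡ k
  |M| = suc-injective (suc-injective (begin
    suc (suc (length M))          ≡⟨ cong suc (length-∷ʳ M last) ⟨
    length (first ∷ M ∷ʳ last)    ≡⟨ ↭-length x↭ ⟩
    length (range1 (suc (suc k))) ≡⟨ length-range1 (suc (suc k)) ⟩
    suc (suc k)                   ∎))
    where open ≡-Reasoning

lemma5 : (n : ℕ) → 3 ≤ n → (x : List ℕ) → x ↭ range1 (n ∸ 1) →
    (PrimitiveG x → PrimitiveG (wordG n x)) × (PrimitiveR x → PrimitiveR (wordR n x))
lemma5 (suc (suc (suc k))) (s≤s (s≤s (s≤s z≤n))) x x↭ = primitiveG , primitiveR
  where
  N = suc (suc (suc k))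
  f = suc (suc k)
  l = suc k

  primitiveG : PrimitiveG x → PrimitiveG (wordG N x)
  primitiveG px with M , x≡ , block≡ ← range1-ends x↭ (proj₁ (proj₂ (proj₁ px))) =
    subst (λ B → PrimitiveG (N ∷ l ∷ B ∷ʳ f)) (sym block≡)
      (primitiveG-extend ≤-refl (subst PrimitiveG x≡ px))

  primitiveR : PrimitiveR x → PrimitiveR (wordR N x)
  primitiveR px with M , x≡ , block≡ ← range1-ends x↭ (proj₁ (proj₂ (proj₁ px))) =
    subst (λ B → PrimitiveR (N ∷ B)) (begin
      reverse (l ∷ M) ∷ʳ f                   ≡⟨ cong (_∷ʳ f) (unfold-reverse l M) ⟩
      (reverse M ∷ʳ l) ∷ʳ f                  ≡⟨ ++-assoc (reverse M) [ l ] [ f ] ⟩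
      reverse M ++ l ∷ f ∷ []                ≡⟨ cong (λ B → reverse B ++ l ∷ f ∷ []) block≡ ⟨
      reverse (innerBlock N x) ++ l ∷ f ∷ [] ∎)
      (primitiveR-extend ≤-refl (subst PrimitiveR x≡ px))
    where open ≡-Reasoning
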